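{- Let $A,B\in\bar{\mathbb{R}}_{max}^{n\times n}$. There exists $i$ with $((A\otimes B)^*)_{ii}=+\infty$ if and only if there exists $k$ with $((B\otimes A)^*)_{kk}=+\infty$.
   Context: $\bar{\mathbb{R}}_{max}=\mathbb{R}\cup\{\pm\infty\}$ with $a\oplus b=\max(a,b)$, $a\otimes b=a+b$, $-\infty$ absorbing; matrix products are max-plus, $M^0$ is the matrix with $0$ on the diagonal and $-\infty$ elsewhere, $M^*=\bigoplus_{k\ge0}M^k$ (entrywise supremum). -}

module Defs where

open import Data.Nat using (ℕ; zero; suc)
import Data.Fin as Fin
open Fin using (Fin)
open import Data.Product using (Σ; ∃; _×_; _,_)
open import Data.Sum using (_⊎_)
open import Data.Empty using (⊥)
open import Relation.Nullary using (¬_; Dec; yes; no)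
open import Relation.Binary.PropositionalEquality using (_≡_)

-- Any model is (classically)
-- isomorphic to ℝ, and the statement quantifies over all models.
record RealField : Set₁ where
  infixl 6 _+_
  infixl 7 _*_
  infix 4 _≤_
  field
    ℝ    : Set
    _+_  : ℝ → ℝ → ℝ
    _*_  : ℝ → ℝ → ℝ
    -_   : ℝ → ℝ
    0# 1# : ℝ
    _≤_  : ℝ → ℝ → Set
    +-assoc     : ∀ x y z → (x + y) + z ≡ x + (y + z)
    +-comm      : ∀ x y → x + y ≡ y + x
    +-identityˡ : ∀ x → 0# + x ≡ x
    -‿inverseˡ  : ∀ x → (- x) + x ≡ 0#
    *-assoc     : ∀ x y z → (x * y) * z ≡ x * (y * z)
    *-comm      : ∀ x y → x * y ≡ y * x
    *-identityˡ : ∀ x → 1# * x ≡ x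
    distribˡ    : ∀ x y z → x * (y + z) ≡ x * y + x * z
    0≢1         : ¬ (0# ≡ 1#)
    *-inverse   : ∀ x → ¬ (x ≡ 0#) → ∃ λ y → x * y ≡ 1#
    ≤-refl      : ∀ x → x ≤ x
    ≤-trans     : ∀ {x y z} → x ≤ y → y ≤ z → x ≤ z
    ≤-antisym   : ∀ {x y} → x ≤ y → y ≤ x → x ≡ y
    _≤?_        : ∀ x y → Dec (x ≤ y)
    ≤-total     : ∀ x y → x ≤ y ⊎ y ≤ x
    +-mono-≤    : ∀ {x y} z → x ≤ y → x + z ≤ y + z
    *-nonneg    : ∀ {x y} → 0# ≤ x → 0# ≤ y → 0# ≤ x * y
    lub : (S : ℝ → Set) → (∃ λ x → S x) → (∃ λ b → ∀ x → S x → x ≤ b) →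
          ∃ λ s → (∀ x → S x → x ≤ s) × (∀ b → (∀ x → S x → x ≤ b) → s ≤ b)

module MaxPlus (R : RealField) where
  open RealField R

  data ℝ̄ : Set where
    -∞  : ℝ̄
    +∞  : ℝ̄
    fin : ℝ → ℝ̄

  data _≤̄_ : ℝ̄ → ℝ̄ → Set where
    -∞≤    : ∀ {x} → -∞ ≤̄ x
    ≤+∞    : ∀ {x} → x ≤̄ +∞
    fin≤fin : ∀ {x y} → x ≤ y → fin x ≤̄ fin y

  _⊕_ : ℝ̄ → ℝ̄ → ℝ̄
  -∞ ⊕ b = b
  +∞ ⊕ b = +∞
  fin x ⊕ -∞ = fin x
  fin x ⊕ +∞ = +∞
  fin x ⊕ fin y with x ≤? y
  ... | yes _ = fin y
  ... | no  _ = fin x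

  -- a ⊗ b = a + b, with -∞ absorbing (so -∞ ⊗ +∞ = -∞)
  _⊗_ : ℝ̄ → ℝ̄ → ℝ̄
  -∞ ⊗ b = -∞
  +∞ ⊗ -∞ = -∞
  +∞ ⊗ +∞ = +∞
  +∞ ⊗ fin _ = +∞
  fin x ⊗ -∞ = -∞
  fin x ⊗ +∞ = +∞
  fin x ⊗ fin y = fin (x + y)

  Mat : ℕ → Set
  Mat n = Fin n → Fin n → ℝ̄

  ⨁ : ∀ {n} → (Fin n → ℝ̄) → ℝ̄
  ⨁ {zero}  f = -∞
  ⨁ {suc n} f = f Fin.zero ⊕ ⨁ (λ i → f (Fin.suc i))

  _⊗ᴹ_ : ∀ {n} → Mat n → Mat n → Mat n
  (A ⊗ᴹ B) i j = ⨁ (λ k → A i k ⊗ B k j)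

  Iᴹ : ∀ {n} → Mat n
  Iᴹ i j with i Fin.≟ j
  ... | yes _ = fin 0#
  ... | no  _ = -∞

  _^_ : ∀ {n} → Mat n → ℕ → Mat n
  M ^ zero  = Iᴹ
  M ^ suc k = M ⊗ᴹ (M ^ k)

  IsSup : (ℝ̄ → Set) → ℝ̄ → Set
  IsSup S s = (∀ x → S x → x ≤̄ s) × (∀ b → (∀ x → S x → x ≤̄ b) → s ≤̄ b)

  -- (M^*)_{ij} = s, where M^* = ⨁_{k≥0} M^k (entrywise supremum)
  StarEntry : ∀ {n} → Mat n → Fin n → Fin n → ℝ̄ → Set
  StarEntry M i j s = IsSup (λ x → ∃ λ k → (M ^ k) i j ≡ x) s

-- The pushing rule (A ⊗ B)^m ⊗ A ≤ A ⊗ (B ⊗ A)^m and the cyclicity of the max-plus trace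
-- bound every diagonal entry of (A ⊗ B)^(m+1) by trace((B ⊗ A)^(m+1)).  Hence if all
-- diagonal entries of (B ⊗ A)^* are bounded, so are those of (A ⊗ B)^*.  Constructively
-- this only shows that not every diagonal entry of (B ⊗ A)^* is bounded; the completeness
-- of the reals supplies the weak excluded middle ¬ Q ⊎ ¬ ¬ Q, which over a finite index
-- set turns ¬ ∀ into ∃ ¬ and so produces the index k.

module Submission where

open import Defs
open import Data.Nat using (ℕ; zero; suc)
open import Data.Fin using (Fin; zero; suc; _≟_)
open import Data.Fin.Properties using (∀-cons)
open import Data.Vec.Functional using (_∷_)
open import Data.Product using (∃; _×_; _,_; proj₁; proj₂)
open import Data.Sum using (_⊎_; inj₁; inj₂)
open import Data.Empty using (⊥-elim)
open import Function.Base using (_∘_)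
open import Function.Bundles using (_⇔_; mk⇔; Equivalence)
open import Relation.Nullary using (¬_; yes; no; contradiction)
open import Relation.Binary.Bundles using (Preorder)
open import Relation.Binary.PropositionalEquality
  using (_≡_; refl; sym; trans; cong; isEquivalence)
import Relation.Binary.Reasoning.Preorder as PreorderReasoning

WeakExcludedMiddle : Set₁
WeakExcludedMiddle = (Q : Set) → ¬ Q ⊎ ¬ ¬ Q

module _ (wem : WeakExcludedMiddle) where

  ¬∀⟶∃¬ : ∀ {n} {P : Fin n → Set} → ¬ (∀ k → P k) → ∃ λ k → ¬ P k
  ¬∀⟶∃¬ {zero}  ¬∀P = contradiction (λ ()) ¬∀P
  ¬∀⟶∃¬ {suc n} {P} ¬∀P with wem (P zero)
  ... | inj₁ ¬P₀  = zero , ¬P₀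
  ... | inj₂ ¬¬P₀ with ¬∀⟶∃¬ {P = P ∘ suc} (λ ∀Ps → ¬¬P₀ (λ P₀ → ¬∀P (∀-cons P₀ ∀Ps)))
  ...   | k , ¬Pk = suc k , ¬Pk

module RealFieldProperties (R : RealField) where
  open RealField R

  -- With x < y, the supremum s of {x} ∪ {y | Q} satisfies s ≤ x exactly when ¬ Q.
  weak-excluded-middle-from-gap : ∀ {x y} → x ≤ y → ¬ x ≡ y → WeakExcludedMiddle
  weak-excluded-middle-from-gap {x} {y} x≤y x≢y Q = decide (lub S (x , inj₁ refl) (y , S≤y))
    where
    S : ℝ → Set
    S z = z ≡ x ⊎ (Q × z ≡ y)

    S≤y : ∀ z → S z → z ≤ y
    S≤y z (inj₁ refl)       = x≤y
    S≤y z (inj₂ (_ , refl)) = ≤-refl y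

    decide : (∃ λ s → (∀ z → S z → z ≤ s) × (∀ b → (∀ z → S z → z ≤ b) → s ≤ b)) →
             ¬ Q ⊎ ¬ ¬ Q
    decide (s , s-ub , s-least) with s ≤? x
    ... | yes s≤x = inj₁ λ q → x≢y (≤-antisym x≤y (≤-trans (s-ub y (inj₂ (q , refl))) s≤x))
    ... | no  s≰x = inj₂ λ ¬q → s≰x (s-least x λ
      { _ (inj₁ refl)    → ≤-refl x
      ; _ (inj₂ (q , _)) → contradiction q ¬q })

  weak-excluded-middle : WeakExcludedMiddle
  weak-excluded-middle with ≤-total 0# 1#
  ... | inj₁ 0≤1 = weak-excluded-middle-from-gap 0≤1 0≢1
  ... | inj₂ 1≤0 = weak-excluded-middle-from-gap 1≤0 (0≢1 ∘ sym)

module MaxPlusProperties (R : RealField) where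
  open RealField R
  open MaxPlus R

  ≤̄-refl : ∀ x → x ≤̄ x
  ≤̄-refl -∞      = -∞≤
  ≤̄-refl +∞      = ≤+∞
  ≤̄-refl (fin x) = fin≤fin (≤-refl x)

  ≤̄-reflexive : ∀ {x y} → x ≡ y → x ≤̄ y
  ≤̄-reflexive {x} refl = ≤̄-refl x

  ≤̄-trans : ∀ {x y z} → x ≤̄ y → y ≤̄ z → x ≤̄ z
  ≤̄-trans -∞≤         _           = -∞≤
  ≤̄-trans ≤+∞         ≤+∞         = ≤+∞
  ≤̄-trans (fin≤fin _) ≤+∞         = ≤+∞
  ≤̄-trans (fin≤fin p) (fin≤fin q) = fin≤fin (≤-trans p q)

  +∞≤̄⇒≡+∞ : ∀ {x} → +∞ ≤̄ x → x ≡ +∞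
  +∞≤̄⇒≡+∞ ≤+∞ = refl

  ≤̄-preorder : Preorder _ _ _
  ≤̄-preorder = record
    { Carrier    = ℝ̄
    ; _≈_        = _≡_
    ; _≲_        = _≤̄_
    ; isPreorder = record
      { isEquivalence = isEquivalence ; reflexive = ≤̄-reflexive ; trans = ≤̄-trans } }

  ⊕-sel : ∀ x y → (x ⊕ y) ≡ x ⊎ (x ⊕ y) ≡ y
  ⊕-sel -∞      y       = inj₂ refl
  ⊕-sel +∞      y       = inj₁ refl
  ⊕-sel (fin x) -∞      = inj₁ refl
  ⊕-sel (fin x) +∞      = inj₂ refl
  ⊕-sel (fin x) (fin y) with x ≤? y
  ... | yes _ = inj₂ refl
  ... | no  _ = inj₁ refl

  x≤̄x⊕y : ∀ x y → x ≤̄ (x ⊕ y)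
  x≤̄x⊕y -∞      y       = -∞≤
  x≤̄x⊕y +∞      y       = ≤+∞
  x≤̄x⊕y (fin x) -∞      = ≤̄-refl (fin x)
  x≤̄x⊕y (fin x) +∞      = ≤+∞
  x≤̄x⊕y (fin x) (fin y) with x ≤? y
  ... | yes x≤y = fin≤fin x≤y
  ... | no  _   = ≤̄-refl (fin x)

  y≤̄x⊕y : ∀ x y → y ≤̄ (x ⊕ y)
  y≤̄x⊕y -∞      y       = ≤̄-refl y
  y≤̄x⊕y +∞      y       = ≤+∞
  y≤̄x⊕y (fin x) -∞      = -∞≤
  y≤̄x⊕y (fin x) +∞      = ≤+∞
  y≤̄x⊕y (fin x) (fin y) with x ≤? y | ≤-total x y
  ... | yes _   | _       = ≤̄-refl (fin y)
  ... | no  x≰y | inj₁ x≤y = contradiction x≤y x≰y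
  ... | no  _   | inj₂ y≤x = fin≤fin y≤x

  ⊕-lub : ∀ {x y z} → x ≤̄ z → y ≤̄ z → (x ⊕ y) ≤̄ z
  ⊕-lub {x} {y} x≤z y≤z with ⊕-sel x y
  ... | inj₁ x⊕y≡x rewrite x⊕y≡x = x≤z
  ... | inj₂ x⊕y≡y rewrite x⊕y≡y = y≤z

  f≤̄⨁f : ∀ {n} (f : Fin n → ℝ̄) k → f k ≤̄ ⨁ f
  f≤̄⨁f f zero    = x≤̄x⊕y (f zero) _
  f≤̄⨁f f (suc k) = ≤̄-trans (f≤̄⨁f (f ∘ suc) k) (y≤̄x⊕y (f zero) _)

  ⨁-lub : ∀ {n} {f : Fin n → ℝ̄} {z} → (∀ k → f k ≤̄ z) → ⨁ f ≤̄ z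
  ⨁-lub {zero}  f≤z = -∞≤
  ⨁-lub {suc n} f≤z = ⊕-lub (f≤z zero) (⨁-lub (f≤z ∘ suc))

  ⨁-mono : ∀ {n} {f g : Fin n → ℝ̄} → (∀ k → f k ≤̄ g k) → ⨁ f ≤̄ ⨁ g
  ⨁-mono {g = g} f≤g = ⨁-lub λ k → ≤̄-trans (f≤g k) (f≤̄⨁f g k)

  ⨁-sel : ∀ {n} (f : Fin n → ℝ̄) → ⨁ f ≡ -∞ ⊎ ∃ λ k → ⨁ f ≡ f k
  ⨁-sel {zero}  f = inj₁ refl
  ⨁-sel {suc n} f with ⊕-sel (f zero) (⨁ (f ∘ suc)) | ⨁-sel (f ∘ suc)
  ... | inj₁ e | _            = inj₂ (zero , e)
  ... | inj₂ e | inj₁ e′       = inj₁ (trans e e′)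
  ... | inj₂ e | inj₂ (k , e′) = inj₂ (suc k , trans e e′)

  ⨁≢+∞ : ∀ {n} {f : Fin n → ℝ̄} → (∀ k → ¬ f k ≡ +∞) → ¬ ⨁ f ≡ +∞
  ⨁≢+∞ {f = f} fk≢+∞ with ⨁-sel f
  ... | inj₁ ⨁f≡-∞       rewrite ⨁f≡-∞ = λ ()
  ... | inj₂ (k , ⨁f≡fk) rewrite ⨁f≡fk = fk≢+∞ k

  -- ⨁ f is either -∞ or attained at some f k.
  ⨁-lub-strict : ∀ {n} {f : Fin n → ℝ̄} {z} (g : ℝ̄ → ℝ̄) → g -∞ ≡ -∞ →
                 (∀ k → g (f k) ≤̄ z) → g (⨁ f) ≤̄ z
  ⨁-lub-strict {f = f} g g-∞≡-∞ gfk≤z with ⨁-sel f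
  ... | inj₁ ⨁f≡-∞       rewrite ⨁f≡-∞ | g-∞≡-∞ = -∞≤
  ... | inj₂ (k , ⨁f≡fk) rewrite ⨁f≡fk = gfk≤z k

  ⊗-comm : ∀ x y → (x ⊗ y) ≡ (y ⊗ x)
  ⊗-comm -∞      -∞      = refl
  ⊗-comm -∞      +∞      = refl
  ⊗-comm -∞      (fin y) = refl
  ⊗-comm +∞      -∞      = refl
  ⊗-comm +∞      +∞      = refl
  ⊗-comm +∞      (fin y) = refl
  ⊗-comm (fin x) -∞      = refl
  ⊗-comm (fin x) +∞      = refl
  ⊗-comm (fin x) (fin y) = cong fin (+-comm x y)

  ⊗-assoc : ∀ x y z → ((x ⊗ y) ⊗ z) ≡ (x ⊗ (y ⊗ z))
  ⊗-assoc -∞      y       z       = refl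
  ⊗-assoc +∞      -∞      z       = refl
  ⊗-assoc +∞      +∞      -∞      = refl
  ⊗-assoc +∞      +∞      +∞      = refl
  ⊗-assoc +∞      +∞      (fin z) = refl
  ⊗-assoc +∞      (fin y) -∞      = refl
  ⊗-assoc +∞      (fin y) +∞      = refl
  ⊗-assoc +∞      (fin y) (fin z) = refl
  ⊗-assoc (fin x) -∞      z       = refl
  ⊗-assoc (fin x) +∞      -∞      = refl
  ⊗-assoc (fin x) +∞      +∞      = refl
  ⊗-assoc (fin x) +∞      (fin z) = refl
  ⊗-assoc (fin x) (fin y) -∞      = refl
  ⊗-assoc (fin x) (fin y) +∞      = refl
  ⊗-assoc (fin x) (fin y) (fin z) = cong fin (+-assoc x y z)

  ⊗-identityˡ : ∀ x → (fin 0# ⊗ x) ≡ x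
  ⊗-identityˡ -∞      = refl
  ⊗-identityˡ +∞      = refl
  ⊗-identityˡ (fin x) = cong fin (+-identityˡ x)

  ⊗-identityʳ : ∀ x → (x ⊗ fin 0#) ≡ x
  ⊗-identityʳ x = trans (⊗-comm x (fin 0#)) (⊗-identityˡ x)

  ⊗-zeroʳ : ∀ x → (x ⊗ -∞) ≡ -∞
  ⊗-zeroʳ -∞      = refl
  ⊗-zeroʳ +∞      = refl
  ⊗-zeroʳ (fin x) = refl

  ⊗-monoˡ : ∀ {x x′} y → x ≤̄ x′ → (x ⊗ y) ≤̄ (x′ ⊗ y)
  ⊗-monoˡ     y       -∞≤         = -∞≤
  ⊗-monoˡ {x} -∞      ≤+∞         rewrite ⊗-zeroʳ x = -∞≤
  ⊗-monoˡ     +∞      ≤+∞         = ≤+∞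
  ⊗-monoˡ     (fin _) ≤+∞         = ≤+∞
  ⊗-monoˡ     -∞      (fin≤fin _) = -∞≤
  ⊗-monoˡ     +∞      (fin≤fin _) = ≤+∞
  ⊗-monoˡ     (fin z) (fin≤fin p) = fin≤fin (+-mono-≤ z p)

  ⊗-monoʳ : ∀ x {y y′} → y ≤̄ y′ → (x ⊗ y) ≤̄ (x ⊗ y′)
  ⊗-monoʳ x {y} {y′} y≤y′ rewrite ⊗-comm x y | ⊗-comm x y′ = ⊗-monoˡ x y≤y′

  module _ {n : ℕ} where

    infix 4 _≤ᴹ_
    _≤ᴹ_ : Mat n → Mat n → Set
    M ≤ᴹ N = ∀ i j → M i j ≤̄ N i j

    ≤ᴹ-preorder : Preorder _ _ _
    ≤ᴹ-preorder = record
      { Carrier    = Mat n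
      ; _≈_        = _≡_
      ; _≲_        = _≤ᴹ_
      ; isPreorder = record
        { isEquivalence = isEquivalence
        ; reflexive     = λ { refl i j → ≤̄-refl _ }
        ; trans         = λ M≤N N≤P i j → ≤̄-trans (M≤N i j) (N≤P i j) } }

    trace : Mat n → ℝ̄
    trace M = ⨁ λ k → M k k

    ⊗ᴹ-monoʳ : ∀ M {N N′} → N ≤ᴹ N′ → (M ⊗ᴹ N) ≤ᴹ (M ⊗ᴹ N′)
    ⊗ᴹ-monoʳ M N≤N′ i j = ⨁-mono λ k → ⊗-monoʳ (M i k) (N≤N′ k j)

    ⊗ᴹ-assoc-≤ : ∀ M N P → ((M ⊗ᴹ N) ⊗ᴹ P) ≤ᴹ (M ⊗ᴹ (N ⊗ᴹ P))
    ⊗ᴹ-assoc-≤ M N P i j = ⨁-lub λ k → ⨁-lub-strict (_⊗ P k j) refl λ l → begin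
      ((M i l ⊗ N l k) ⊗ P k j)   ≡⟨ ⊗-assoc (M i l) (N l k) (P k j) ⟩
      (M i l ⊗ (N l k ⊗ P k j))   ≲⟨ ⊗-monoʳ (M i l) (f≤̄⨁f (λ k → N l k ⊗ P k j) k) ⟩
      (M i l ⊗ (N ⊗ᴹ P) l j)      ≲⟨ f≤̄⨁f (λ l → M i l ⊗ (N ⊗ᴹ P) l j) l ⟩
      (M ⊗ᴹ (N ⊗ᴹ P)) i j         ∎
      where open PreorderReasoning ≤̄-preorder

    ⊗ᴹ-assoc-≥ : ∀ M N P → (M ⊗ᴹ (N ⊗ᴹ P)) ≤ᴹ ((M ⊗ᴹ N) ⊗ᴹ P)
    ⊗ᴹ-assoc-≥ M N P i j = ⨁-lub λ l → ⨁-lub-strict (M i l ⊗_) (⊗-zeroʳ (M i l)) λ k → begin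
      (M i l ⊗ (N l k ⊗ P k j))   ≡⟨ sym (⊗-assoc (M i l) (N l k) (P k j)) ⟩
      ((M i l ⊗ N l k) ⊗ P k j)   ≲⟨ ⊗-monoˡ (P k j) (f≤̄⨁f (λ l → M i l ⊗ N l k) l) ⟩
      ((M ⊗ᴹ N) i k ⊗ P k j)      ≲⟨ f≤̄⨁f (λ k → (M ⊗ᴹ N) i k ⊗ P k j) k ⟩
      ((M ⊗ᴹ N) ⊗ᴹ P) i j         ∎
      where open PreorderReasoning ≤̄-preorder

    Iᴹ-diag : ∀ i → Iᴹ {n} i i ≡ fin 0#
    Iᴹ-diag i with i ≟ i
    ... | yes _   = refl
    ... | no  i≢i = contradiction refl i≢i

    ⊗ᴹ-identityˡ-≤ : ∀ M → (Iᴹ ⊗ᴹ M) ≤ᴹ M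
    ⊗ᴹ-identityˡ-≤ M i j = ⨁-lub Iik⊗Mkj≤Mij
      where
      Iik⊗Mkj≤Mij : ∀ k → (Iᴹ i k ⊗ M k j) ≤̄ M i j
      Iik⊗Mkj≤Mij k with i ≟ k
      ... | yes refl = ≤̄-reflexive (⊗-identityˡ (M i j))
      ... | no  _    = -∞≤

    ⊗ᴹ-identityʳ-≥ : ∀ M → M ≤ᴹ (M ⊗ᴹ Iᴹ)
    ⊗ᴹ-identityʳ-≥ M i j = begin
      M i j            ≡⟨ sym (⊗-identityʳ (M i j)) ⟩
      (M i j ⊗ fin 0#) ≡⟨ cong (M i j ⊗_) (sym (Iᴹ-diag j)) ⟩
      (M i j ⊗ Iᴹ j j) ≲⟨ f≤̄⨁f (λ k → M i k ⊗ Iᴹ k j) j ⟩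
      (M ⊗ᴹ Iᴹ) i j    ∎
      where open PreorderReasoning ≤̄-preorder

    ⊗ᴹ-diag≤trace-swap : ∀ M N {P} → (N ⊗ᴹ M) ≤ᴹ P → ∀ i → (M ⊗ᴹ N) i i ≤̄ trace P
    ⊗ᴹ-diag≤trace-swap M N {P} NM≤P i = ⨁-lub λ k → begin
      (M i k ⊗ N k i)   ≡⟨ ⊗-comm (M i k) (N k i) ⟩
      (N k i ⊗ M i k)   ≲⟨ f≤̄⨁f (λ l → N k l ⊗ M l k) i ⟩
      (N ⊗ᴹ M) k k      ≲⟨ NM≤P k k ⟩
      P k k             ≲⟨ f≤̄⨁f (λ l → P l l) k ⟩
      trace P           ∎
      where open PreorderReasoning ≤̄-preorder

    ⊗ᴹ-power-shift : ∀ A B m → (((A ⊗ᴹ B) ^ m) ⊗ᴹ A) ≤ᴹ (A ⊗ᴹ ((B ⊗ᴹ A) ^ m))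
    ⊗ᴹ-power-shift A B zero = begin
      (Iᴹ ⊗ᴹ A)   ≲⟨ ⊗ᴹ-identityˡ-≤ A ⟩
      A           ≲⟨ ⊗ᴹ-identityʳ-≥ A ⟩
      (A ⊗ᴹ Iᴹ)   ∎
      where open PreorderReasoning ≤ᴹ-preorder
    ⊗ᴹ-power-shift A B (suc m) = begin
      ((AB ⊗ᴹ (AB ^ m)) ⊗ᴹ A)       ≲⟨ ⊗ᴹ-assoc-≤ AB (AB ^ m) A ⟩
      (AB ⊗ᴹ ((AB ^ m) ⊗ᴹ A))       ≲⟨ ⊗ᴹ-monoʳ AB (⊗ᴹ-power-shift A B m) ⟩
      (AB ⊗ᴹ (A ⊗ᴹ (BA ^ m)))      ≲⟨ ⊗ᴹ-assoc-≤ A B (A ⊗ᴹ (BA ^ m)) ⟩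
      (A ⊗ᴹ (B ⊗ᴹ (A ⊗ᴹ (BA ^ m)))) ≲⟨ ⊗ᴹ-monoʳ A (⊗ᴹ-assoc-≥ B A (BA ^ m)) ⟩
      (A ⊗ᴹ (BA ⊗ᴹ (BA ^ m)))      ∎
      where
      open PreorderReasoning ≤ᴹ-preorder
      AB BA : Mat n
      AB = A ⊗ᴹ B
      BA = B ⊗ᴹ A

    ⊗ᴹ-power-diag≤trace-swap : ∀ A B m i →
                               ((A ⊗ᴹ B) ^ suc m) i i ≤̄ trace ((B ⊗ᴹ A) ^ suc m)
    ⊗ᴹ-power-diag≤trace-swap A B m i =
      ≤̄-trans (⊗ᴹ-assoc-≤ A B (AB ^ m) i i) (⊗ᴹ-diag≤trace-swap A (B ⊗ᴹ (AB ^ m)) shifted i)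
      where
      open PreorderReasoning ≤ᴹ-preorder
      AB BA : Mat n
      AB = A ⊗ᴹ B
      BA = B ⊗ᴹ A
      shifted : ((B ⊗ᴹ (AB ^ m)) ⊗ᴹ A) ≤ᴹ (BA ^ suc m)
      shifted = begin
        ((B ⊗ᴹ (AB ^ m)) ⊗ᴹ A)   ≲⟨ ⊗ᴹ-assoc-≤ B (AB ^ m) A ⟩
        (B ⊗ᴹ ((AB ^ m) ⊗ᴹ A))   ≲⟨ ⊗ᴹ-monoʳ B (⊗ᴹ-power-shift A B m) ⟩
        (B ⊗ᴹ (A ⊗ᴹ (BA ^ m)))  ≲⟨ ⊗ᴹ-assoc-≥ B A (BA ^ m) ⟩
        (BA ⊗ᴹ (BA ^ m))        ∎

  BoundedStarEntry : ∀ {n} → Mat n → Fin n → Fin n → Set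
  BoundedStarEntry M i j = ∃ λ b → ¬ b ≡ +∞ × ∀ m → (M ^ m) i j ≤̄ b

  StarEntry+∞⇔¬Bounded : ∀ {n} (M : Mat n) i j → StarEntry M i j +∞ ⇔ (¬ BoundedStarEntry M i j)
  StarEntry+∞⇔¬Bounded M i j = mk⇔ to from
    where
    to : StarEntry M i j +∞ → ¬ BoundedStarEntry M i j
    to (_ , least) (b , b≢+∞ , bound) = b≢+∞ (+∞≤̄⇒≡+∞ (least b λ { _ (m , refl) → bound m }))

    from : ¬ BoundedStarEntry M i j → StarEntry M i j +∞
    from unbounded = (λ _ _ → ≤+∞) , least
      where
      least : ∀ b → (∀ x → (∃ λ m → (M ^ m) i j ≡ x) → x ≤̄ b) → +∞ ≤̄ b
      least +∞      _     = ≤+∞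
      least -∞      bound = ⊥-elim (unbounded (-∞ , (λ ()) , λ m → bound _ (m , refl)))
      least (fin y) bound = ⊥-elim (unbounded (fin y , (λ ()) , λ m → bound _ (m , refl)))

  BoundedStarEntry-diag-swap : ∀ {n} (A B : Mat n) →
    (∀ k → BoundedStarEntry (B ⊗ᴹ A) k k) → ∀ i → BoundedStarEntry (A ⊗ᴹ B) i i
  BoundedStarEntry-diag-swap {n} A B bounded i = ⨁ b , ⨁≢+∞ b≢+∞ , ≤b
    where
    b : Fin (suc n) → ℝ̄
    b = fin 0# ∷ λ k → proj₁ (bounded k)

    b≢+∞ : ∀ k → ¬ b k ≡ +∞
    b≢+∞ zero    = λ ()
    b≢+∞ (suc k) = proj₁ (proj₂ (bounded k))

    ≤b : ∀ m → ((A ⊗ᴹ B) ^ m) i i ≤̄ ⨁ b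
    ≤b zero    = ≤̄-trans (≤̄-reflexive (Iᴹ-diag i)) (f≤̄⨁f b zero)
    ≤b (suc m) = begin
      ((A ⊗ᴹ B) ^ suc m) i i      ≲⟨ ⊗ᴹ-power-diag≤trace-swap A B m i ⟩
      trace ((B ⊗ᴹ A) ^ suc m)    ≲⟨ ⨁-mono (λ k → proj₂ (proj₂ (bounded k)) (suc m)) ⟩
      ⨁ (b ∘ suc)                 ≲⟨ y≤̄x⊕y (fin 0#) (⨁ (b ∘ suc)) ⟩
      ⨁ b                         ∎
      where open PreorderReasoning ≤̄-preorder

  StarEntry+∞-diag-swap : WeakExcludedMiddle → ∀ {n} (A B : Mat n) →
    (∃ λ i → StarEntry (A ⊗ᴹ B) i i +∞) → ∃ λ k → StarEntry (B ⊗ᴹ A) k k +∞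
  StarEntry+∞-diag-swap wem A B (i , ABᵢᵢ) =
    let k , ¬boundedₖ = ¬∀⟶∃¬ wem ¬all-bounded
    in  k , Equivalence.from (StarEntry+∞⇔¬Bounded (B ⊗ᴹ A) k k) ¬boundedₖ
    where
    ¬all-bounded : ¬ (∀ k → BoundedStarEntry (B ⊗ᴹ A) k k)
    ¬all-bounded bounded = Equivalence.to (StarEntry+∞⇔¬Bounded (A ⊗ᴹ B) i i) ABᵢᵢ
                             (BoundedStarEntry-diag-swap A B bounded i)

proposition6 : (R : RealField) → let open MaxPlus R in
    (n : ℕ) (A B : Mat n) →
    (∃ λ (i : Fin n) → StarEntry (A ⊗ᴹ B) i i +∞) ⇔ (∃ λ (k : Fin n) → StarEntry (B ⊗ᴹ A) k k +∞)
proposition6 R n A B = mk⇔ (StarEntry+∞-diag-swap wem A B) (StarEntry+∞-diag-swap wem B A)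
  where
  open MaxPlusProperties R
  open RealFieldProperties R using () renaming (weak-excluded-middle to wem)
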